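{- Let $P=(P_j)_{j\in\omega}$ be a countable partition of $\omega$ into sets none of which belongs to $\mathcal F$. Then the partition cut $C_P$ is a sub-semiring of ${}^*\mathbb N$, i.e. it is closed under addition and multiplication.
   Context: $\mathcal F$ is a nonprincipal (equivalently countably incomplete) ultrafilter on $\omega$ and ${}^*\mathbb N=\mathbb N^\omega/\mathcal F$, elements written $[n_i]$ for sequences $(n_i)_{i\in\omega}$. A set is small if it is not in $\mathcal F$. For a countable partition $P=(P_j)_{j\in\omega}$ of $\omega$ into small sets, the partition cut is $C_P=\{[n_i]:\forall j\in\omega\ \exists b\in\mathbb N\ \forall i\in P_j,\ n_i\le b\}$, i.e. the set of elements of ${}^*\mathbb N$ having some representative bounded separately on each $P_j$. -}

module Defs where

open import Data.Nat using (ℕ; _+_; _*_; _≤_)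
open import Data.Product using (Σ; _×_; ∃)
open import Data.Sum using (_⊎_)
open import Relation.Binary.PropositionalEquality using (_≡_)
open import Relation.Nullary using (¬_)

Subset : Set₁
Subset = ℕ → Set

_∩_ : Subset → Subset → Subset
(A ∩ B) i = A i × B i

∁ : Subset → Subset
∁ A i = ¬ A i

_⊆_ : Subset → Subset → Set
A ⊆ B = ∀ i → A i → B i

record Ultrafilter (F : Subset → Set) : Set₁ where
  field
    whole      : F (λ _ → ℕ)
    proper     : ¬ F (λ _ → _≡_ 0 1)
    upward     : ∀ {A B} → A ⊆ B → F A → F B
    intersect  : ∀ {A B} → F A → F B → F (A ∩ B)
    ultra      : ∀ A → F A ⊎ F (∁ A)

NonPrincipal : (Subset → Set) → Set
NonPrincipal F = ∀ k → ¬ F (λ i → i ≡ k)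

Small : (Subset → Set) → Subset → Set
Small F A = ¬ F A

-- Elements of *ℕ = ℕ^ω / F are represented by sequences; equality in the
-- ultrapower is agreement on a set in F.
Seq : Set
Seq = ℕ → ℕ

_≈[_]_ : Seq → (Subset → Set) → Seq → Set
n ≈[ F ] m = F (λ i → n i ≡ m i)

-- A countable partition (P_j)_{j∈ω} of ω is given by the block-index map
-- p : ω → ω, with P_j = { i | p i ≡ j }.
Block : (ℕ → ℕ) → ℕ → Subset
Block p j i = p i ≡ j

BoundedOnBlocks : (ℕ → ℕ) → Seq → Set
BoundedOnBlocks p n = ∀ j → ∃ λ b → ∀ i → Block p j i → n i ≤ b

InCut : (Subset → Set) → (ℕ → ℕ) → Seq → Set
InCut F p n = ∃ λ n′ → (n′ ≈[ F ] n) × BoundedOnBlocks p n′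

_⊕_ : Seq → Seq → Seq
(n ⊕ m) i = n i + m i

_⊗_ : Seq → Seq → Seq
(n ⊗ m) i = n i * m i

{-# OPTIONS --safe #-}
module Submission where

open import Defs
open import Data.Nat using (ℕ; _≤_)
open import Data.Nat.Properties using (≤-refl; +-mono-≤; *-mono-≤)
open import Data.Product using (_×_; _,_)
open import Relation.Binary.Core using (_Preserves₂_⟶_⟶_)
open import Relation.Binary.PropositionalEquality using (refl; cong₂)

zipWith : (ℕ → ℕ → ℕ) → Seq → Seq → Seq
zipWith _∙_ n m i = n i ∙ m i

boundedOnBlocks-const : ∀ p c → BoundedOnBlocks p (λ _ → c)
boundedOnBlocks-const p c j = c , λ _ _ → ≤-refl

boundedOnBlocks-zipWith : ∀ {_∙_} → _∙_ Preserves₂ _≤_ ⟶ _≤_ ⟶ _≤_ →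
  ∀ {p n m} → BoundedOnBlocks p n → BoundedOnBlocks p m →
  BoundedOnBlocks p (zipWith _∙_ n m)
boundedOnBlocks-zipWith {_∙_} mono bn bm j
  with bn j | bm j
... | b , n≤b | c , m≤c = b ∙ c , λ i i∈Pj → mono (n≤b i i∈Pj) (m≤c i i∈Pj)

module _ {F : Subset → Set} (U : Ultrafilter F) where
  open Ultrafilter U

  ≈-refl : ∀ n → n ≈[ F ] n
  ≈-refl n = upward (λ _ _ → refl) whole

  ≈-zipWith : ∀ _∙_ {n n′ m m′} → n′ ≈[ F ] n → m′ ≈[ F ] m →
    zipWith _∙_ n′ m′ ≈[ F ] zipWith _∙_ n m
  ≈-zipWith _∙_ n′≈n m′≈m =
    upward (λ _ (eqₙ , eqₘ) → cong₂ _∙_ eqₙ eqₘ) (intersect n′≈n m′≈m)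

  inCut-const : ∀ p c → InCut F p (λ _ → c)
  inCut-const p c = (λ _ → c) , ≈-refl (λ _ → c) , boundedOnBlocks-const p c

  inCut-zipWith : ∀ {_∙_} → _∙_ Preserves₂ _≤_ ⟶ _≤_ ⟶ _≤_ →
    ∀ {p n m} → InCut F p n → InCut F p m → InCut F p (zipWith _∙_ n m)
  inCut-zipWith {_∙_} mono (n′ , n′≈n , bn′) (m′ , m′≈m , bm′) =
    zipWith _∙_ n′ m′ , ≈-zipWith _∙_ n′≈n m′≈m , boundedOnBlocks-zipWith mono bn′ bm′

-- Closure holds for every partition; nonprincipality and smallness of the
-- blocks are only needed to make C_P a proper cut, not for this.
propositionA5 : (F : Subset → Set) → Ultrafilter F → NonPrincipal F →
    (p : ℕ → ℕ) → (∀ j → Small F (Block p j)) →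
    (InCut F p (λ _ → 0) × InCut F p (λ _ → 1)) ×
    (∀ n m → InCut F p n → InCut F p m → InCut F p (n ⊕ m)) ×
    (∀ n m → InCut F p n → InCut F p m → InCut F p (n ⊗ m))
propositionA5 F U _ p _ =
  (inCut-const U p 0 , inCut-const U p 1) ,
  (λ _ _ → inCut-zipWith U +-mono-≤) ,
  (λ _ _ → inCut-zipWith U *-mono-≤)
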